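{- Let $J$ be an interval partition such that for each $n\in\omega$ there is $l_n\in\omega$ with $l_n>0$, $l_n\geq n$ and $|J_n|=2^{l_n}$. Let $\bar{A}=\langle A_{n,\sigma}: n\in\omega,\ \sigma\in 2^{\leq l_n}\rangle$ be such that for each $n\in\omega$: (i) for each $m\leq l_n$ the sets $A_{n,\sigma}$, $\sigma\in 2^m$, are pairwise disjoint with union $J_n$; (ii) $|A_{n,\sigma}|=2^{l_n-|\sigma|}$ for all $\sigma\in2^{\leq l_n}$, and $\sigma\subseteq\tau$ implies $A_{n,\tau}\subseteq A_{n,\sigma}$; (iii) for each $\sigma\in 2^{\leq l_n}$ and distinct $i,j\in A_{n,\sigma}$, $|i-j|>2^{|\sigma|-1}$. Let $f\in\mathcal{F}_{J,\bar{A}}$ and let $I$ be any interval partition. Then $Z_{I,J,f}$ has asymptotic density $0$.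
   Context: An interval partition is given by a strictly increasing sequence $\langle i_n:n\in\omega\rangle$ with $i_0=0$; its $n$-th interval is $I_n=[i_n,i_{n+1})$. $\mathcal{F}_{J,\bar{A}}$ is the set of all $f\in\omega^\omega$ such that for each $n\in\omega$ and each $l<l_n$ there is $\sigma\in2^{l+1}$ with $f^{ -1}(\{l\})\cap J_n=A_{n,\sigma}$, and there is $\tau\in2^{l_n}$ with $f^{ -1}(\{l_n\})\cap J_n=A_{n,\tau}$. For an interval partition $I$, $f\in\mathcal{F}_{J,\bar{A}}$ and $l\in\omega$, $Z_{I,J,f,l}=\{m\in\omega:\exists k\in I_l\,[m\in J_k\wedge f(m)\geq l]\}$, and $Z_{I,J,f}=\bigcup_{l\in\omega}Z_{I,J,f,l}$. A set $A\subseteq\omega$ has asymptotic density $0$ if $\lim_{n\to\infty}|A\cap n|/n=0$; here $2^{\leq l}$ denotes the set of binary sequences of length at most $l$ and $|\sigma|$ the length of $\sigma$. -}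

module Defs where

open import Data.Nat using (ℕ; zero; suc; _+_; _*_; _∸_; _^_; _≤_; _<_; ∣_-_∣)
open import Data.Bool using (Bool)
open import Data.List using (List; length; _++_)
open import Data.List.Membership.Propositional using (_∈_)
open import Data.List.Relation.Unary.Unique.Propositional using (Unique)
open import Data.Product using (Σ; ∃; _×_; _,_)
open import Data.Empty using (⊥)
open import Data.Integer using (+_)
open import Data.Rational using (ℚ; 0ℚ; _/_) renaming (_<_ to _<ℚ_)
open import Relation.Binary.PropositionalEquality using (_≡_; _≢_)

Subset : Set₁
Subset = ℕ → Set

HasCard : Subset → ℕ → Set
HasCard P c = Σ (List ℕ) λ xs → Unique xs × (∀ x → x ∈ xs → P x) × (∀ x → P x → x ∈ xs) × length xs ≡ c

-- Asymptotic density 0:  lim_{n→∞} |A ∩ n| / n = 0  (n ranging over positive naturals).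
DensityZero : Subset → Set
DensityZero A = (ε : ℚ) → 0ℚ <ℚ ε → Σ ℕ λ N → (n : ℕ) → N ≤ n → (c : ℕ) →
  HasCard (λ m → m < suc n × A m) c → ((+ c) / suc n) <ℚ ε

IsIntervalPartition : (ℕ → ℕ) → Set
IsIntervalPartition i = (i 0 ≡ 0) × (∀ n → i n < i (suc n))

-- m ∈ I_n = [i n, i (n+1))
InInterval : (ℕ → ℕ) → ℕ → ℕ → Set
InInterval i n m = (i n ≤ m) × (m < i (suc n))

-- σ ⊆ τ for binary sequences: σ is an initial segment of τ
IsPrefix : List Bool → List Bool → Set
IsPrefix σ τ = Σ (List Bool) λ ρ → τ ≡ σ ++ ρ

-- Family Ā = ⟨A n σ⟩ ; only σ with length σ ≤ l n are relevant.
Family : Set₁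
Family = ℕ → List Bool → Subset

-- Hypotheses (i)-(iii) on Ā relative to J (sequence j) and the lengths l.
-- (iii): |i - j| > 2^(|σ|-1) is written as 2^|σ| < 2·|i - j| (exact, also for |σ| = 0).
GoodFamily : (j : ℕ → ℕ) (l : ℕ → ℕ) → Family → Set
GoodFamily j l A = ∀ n →
  ((m : ℕ) → m ≤ l n →
     ((σ τ : List Bool) → length σ ≡ m → length τ ≡ m → σ ≢ τ →
        ∀ x → A n σ x → A n τ x → ⊥)
   × (∀ x → InInterval j n x → Σ (List Bool) λ σ → length σ ≡ m × A n σ x)
   × ((σ : List Bool) → length σ ≡ m → ∀ x → A n σ x → InInterval j n x))
  ×
  ((σ : List Bool) → length σ ≤ l n → HasCard (A n σ) (2 ^ (l n ∸ length σ)))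
  × ((σ τ : List Bool) → length τ ≤ l n → IsPrefix σ τ → ∀ x → A n τ x → A n σ x)
  ×
  ((σ : List Bool) → length σ ≤ l n → ∀ a b → A n σ a → A n σ b → a ≢ b →
     2 ^ length σ < 2 * ∣ a - b ∣)

InF : (j : ℕ → ℕ) (l : ℕ → ℕ) → Family → (ℕ → ℕ) → Set
InF j l A f = ∀ n →
  ((k : ℕ) → k < l n → Σ (List Bool) λ σ → length σ ≡ suc k ×
     (∀ x → (f x ≡ k × InInterval j n x) → A n σ x)
   × (∀ x → A n σ x → (f x ≡ k × InInterval j n x)))
  × (Σ (List Bool) λ τ → length τ ≡ l n ×
     (∀ x → (f x ≡ l n × InInterval j n x) → A n τ x)
   × (∀ x → A n τ x → (f x ≡ l n × InInterval j n x)))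

Z : (i j : ℕ → ℕ) (f : ℕ → ℕ) → Subset
Z i j f m = Σ ℕ λ l → Σ ℕ λ k → InInterval i l k × InInterval j k m × l ≤ f m

module Submission where

open import Defs
open import Data.Bool using (Bool; not)
open import Data.Bool.Properties using (¬-not)
open import Data.Fin as Fin using (Fin; zero; suc; toℕ; fromℕ<)
open import Data.Fin.Properties using (toℕ<n; toℕ-fromℕ<; injective⇒≤)
open import Data.Integer as ℤ using (ℤ; -[1+_]; +<+)
open import Data.Integer.Properties using (pos-*)
open import Data.List using (List; []; _∷_; length; lookup; drop)
open import Data.List.Membership.Propositional using (_∈_)
open import Data.List.Membership.Propositional.Properties using (∈-lookup)
open import Data.List.Relation.Unary.All as All using ()
open import Data.List.Relation.Unary.AllPairs using (_∷_)
open import Data.List.Relation.Unary.Any using (here)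
open import Data.List.Relation.Unary.Unique.Propositional using (Unique)
open import Data.Nat
open import Data.Nat.DivMod
open import Data.Nat.Properties
open import Data.Parity using (Parity; 0ℙ; 1ℙ; _⁻¹)
open import Data.Parity.Properties using (p≢p⁻¹; suc-homo-⁻¹)
open import Data.Product using (∃-syntax; _×_; _,_; proj₁; proj₂)
open import Data.Rational as ℚ using (ℚ; mkℚ; ↥_; ↧_; *<*)
open import Data.Rational.Properties using (toℚᵘ-cancel-<; toℚᵘ-fromℚᵘ)
open import Data.Rational.Unnormalised as ℚᵘ using (mkℚᵘ)
import Data.Rational.Unnormalised.Properties as ℚᵘ
open import Data.Sum using (_⊎_; inj₁; inj₂)
open import Function.Definitions using (Injective)
open import Relation.Binary.Definitions using (tri<; tri≈; tri>)
open import Relation.Binary.PropositionalEquality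
open import Relation.Nullary using (¬_; contradiction; yes; no)

-- Fix Q and L = 4Q + 1.  Inside a block J_k with L ≤ l_k, the points where f ≥ L lie
-- in a single cell A_{k,τ} with |τ| = L: for a < L the level set f⁻¹(a) ∩ J_k is a cell
-- A_{k,σ_a} with |σ_a| = a + 1, and there is only one string of length L extending none
-- of the σ_a.  By (iii) these points are more than d = 2^(L-1) apart.  Beyond j(i_L)
-- every point of Z has f ≥ L and every block is longer than d, so a window [w d, (w+1) d)
-- meets at most two such blocks, of different parity, and contains at most two points
-- of Z.  Hence |Z ∩ (n+1)| ≤ j(i_L) + 2 n/d + 2, which is eventually below (n+1)/Q.

lookup-injective : ∀ {A : Set} {xs : List A} → Unique xs →
  ∀ a b → lookup xs a ≡ lookup xs b → a ≡ b
lookup-injective (_ ∷ _) zero zero _ = refl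
lookup-injective (x∉xs ∷ _) zero (suc b) eq = contradiction eq (All.lookup x∉xs (∈-lookup b))
lookup-injective (x∉xs ∷ _) (suc a) zero eq = contradiction (sym eq) (All.lookup x∉xs (∈-lookup a))
lookup-injective (_ ∷ xs-unique) (suc a) (suc b) eq = cong suc (lookup-injective xs-unique a b eq)

length≤-of-injectiveCoding : ∀ {A : Set} (R : A → ℕ → Set) {M} {xs : List A} → Unique xs →
  (∀ {x} → x ∈ xs → ∃[ c ] c < M × R x c) → (∀ {x y c} → R x c → R y c → x ≡ y) →
  length xs ≤ M
length≤-of-injectiveCoding R {M} {xs} xs-unique coding R-injective = injective⇒≤ code-injective
  where
  c : Fin (length xs) → ℕ
  c a = proj₁ (coding (∈-lookup a))

  code : Fin (length xs) → Fin M
  code a = fromℕ< (proj₁ (proj₂ (coding (∈-lookup a))))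

  c-sound : ∀ a → R (lookup xs a) (c a)
  c-sound a = proj₂ (proj₂ (coding (∈-lookup a)))

  code-injective : Injective _≡_ _≡_ code
  code-injective {a} {b} eq = lookup-injective xs-unique a b
    (R-injective (c-sound a) (subst (R _) (sym c-eq) (c-sound b)))
    where
    c-eq : c a ≡ c b
    c-eq = trans (sym (toℕ-fromℕ< _)) (trans (cong toℕ eq) (toℕ-fromℕ< _))

∷-prefix : ∀ t {σ τ : List Bool} → IsPrefix σ τ → IsPrefix (t ∷ σ) (t ∷ τ)
∷-prefix t (ρ , τ≡σρ) = ρ , cong (t ∷_) τ≡σρ

avoid-[b]⇒head≡not : ∀ {b c} s → ¬ IsPrefix (b ∷ []) (c ∷ s) → c ≡ not b
avoid-[b]⇒head≡not s ¬pre = ¬-not (λ c≡b → ¬pre (s , cong (_∷ s) c≡b))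

-- Every σ (suc a) starts with the complement of the single bit of σ zero, and so does every
-- avoider; hence an avoider is forced bit by bit, its bit a being the complement of the last bit of σ a.
avoider-unique : ∀ {L} (σ : Fin L → List Bool) →
  (∀ a → length (σ a) ≡ suc (toℕ a)) →
  (∀ {a b} → a Fin.< b → ¬ IsPrefix (σ a) (σ b)) →
  ∀ τ τ′ → length τ ≡ L → length τ′ ≡ L →
  (∀ a → ¬ IsPrefix (σ a) τ) → (∀ a → ¬ IsPrefix (σ a) τ′) → τ ≡ τ′
avoider-unique {zero} σ _ _ [] [] _ _ _ _ = refl
avoider-unique {suc L} σ |σ| incomparable (t ∷ τ) (t′ ∷ τ′) |τ| |τ′| avoids avoids′
  with σ zero in σ₀≡ | |σ| zero
... | b ∷ [] | _ =
  cong₂ _∷_ (trans (first-bit τ (avoids zero)) (sym (first-bit τ′ (avoids′ zero))))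
    (avoider-unique σ′ |σ′| incomparable′ τ τ′ (suc-injective |τ|) (suc-injective |τ′|)
      (tail-avoids τ (first-bit τ (avoids zero)) avoids) (tail-avoids τ′ (first-bit τ′ (avoids′ zero)) avoids′))
  where
  first-bit : ∀ {c} s → ¬ IsPrefix (σ zero) (c ∷ s) → c ≡ not b
  first-bit s ¬pre = avoid-[b]⇒head≡not s (λ pre → ¬pre (subst (λ u → IsPrefix u _) (sym σ₀≡) pre))

  σ′ : Fin L → List Bool
  σ′ a = drop 1 (σ (suc a))

  peel : ∀ a → σ (suc a) ≡ not b ∷ σ′ a
  peel a with σ (suc a) | |σ| (suc a) | incomparable {zero} {suc a} z<s
  ... | c ∷ s | _ | ¬pre = cong (_∷ s) (first-bit s ¬pre)

  |σ′| : ∀ a → length (σ′ a) ≡ suc (toℕ a)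
  |σ′| a = suc-injective (trans (cong length (sym (peel a))) (|σ| (suc a)))

  incomparable′ : ∀ {a a′} → a Fin.< a′ → ¬ IsPrefix (σ′ a) (σ′ a′)
  incomparable′ {a} {a′} a<a′ pre =
    incomparable (s<s a<a′) (subst₂ IsPrefix (sym (peel a)) (sym (peel a′)) (∷-prefix (not b) pre))

  tail-avoids : ∀ {c} s → c ≡ not b → (∀ a → ¬ IsPrefix (σ a) (c ∷ s)) → ∀ a → ¬ IsPrefix (σ′ a) s
  tail-avoids s refl avoid a pre = avoid (suc a) (subst (λ u → IsPrefix u _) (sym (peel a)) (∷-prefix (not b) pre))

module HighValues {j l : ℕ → ℕ} {A : Family} {f : ℕ → ℕ}
  (good : GoodFamily j l A) (f∈F : InF j l A f) (k : ℕ) where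

  level : (a : ℕ) → a < l k → List Bool
  level a a<l = proj₁ (proj₁ (f∈F k) a a<l)

  level-length : ∀ a a<l → length (level a a<l) ≡ suc a
  level-length a a<l = proj₁ (proj₂ (proj₁ (f∈F k) a a<l))

  level-value : ∀ a a<l x → A k (level a a<l) x → f x ≡ a
  level-value a a<l x x∈A = proj₁ (proj₂ (proj₂ (proj₂ (proj₁ (f∈F k) a a<l))) x x∈A)

  nested : ∀ σ τ → length τ ≤ l k → IsPrefix σ τ → ∀ x → A k τ x → A k σ x
  nested = proj₁ (proj₂ (proj₂ (good k)))

  nonempty : ∀ σ → length σ ≤ l k → ∃[ x ] A k σ x
  nonempty σ |σ|≤l with proj₁ (proj₂ (good k)) σ |σ|≤l
  ... | [] , _ , _ , _ , 0≡2^ = contradiction 0≡2^ (<⇒≢ (m^n>0 2 (l k ∸ length σ)))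
  ... | x ∷ _ , _ , sound , _ , _ = x , sound x (here refl)

  cover : ∀ {L} → L ≤ l k → ∀ {x} → InInterval j k x → ∃[ τ ] length τ ≡ L × A k τ x
  cover {L} L≤l = proj₁ (proj₂ (proj₁ (good k) L L≤l)) _

  spread : ∀ τ → length τ ≤ l k → ∀ x y → A k τ x → A k τ y → x ≢ y → 2 ^ length τ < 2 * ∣ x - y ∣
  spread = proj₂ (proj₂ (proj₂ (good k)))

  module _ {L} (L≤l : L ≤ l k) where

    levels : Fin L → List Bool
    levels a = level (toℕ a) (<-≤-trans (toℕ<n a) L≤l)

    levels-length : ∀ a → length (levels a) ≡ suc (toℕ a)
    levels-length a = level-length _ _

    levels-length≤ : ∀ a → length (levels a) ≤ l k
    levels-length≤ a = subst (_≤ l k) (sym (levels-length a)) (<-≤-trans (toℕ<n a) L≤l)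

    levels-incomparable : ∀ {a b} → a Fin.< b → ¬ IsPrefix (levels a) (levels b)
    levels-incomparable {a} {b} a<b pre with nonempty (levels b) (levels-length≤ b)
    ... | z , z∈Ab = <⇒≢ a<b (trans (sym (level-value _ _ z (nested _ _ (levels-length≤ b) pre z z∈Ab)))
                                     (level-value _ _ z z∈Ab))

    high-avoids : ∀ {τ x} → length τ ≡ L → A k τ x → L ≤ f x → ∀ a → ¬ IsPrefix (levels a) τ
    high-avoids {τ} {x} |τ| x∈Aτ L≤fx a pre = <⇒≱ (toℕ<n a)
      (subst (L ≤_) (level-value _ _ x (nested _ τ (subst (_≤ l k) (sym |τ|) L≤l) pre x x∈Aτ)) L≤fx)

    high-cell-unique : ∀ {τ τ′ x y} → length τ ≡ L → length τ′ ≡ L → A k τ x → A k τ′ y →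
      L ≤ f x → L ≤ f y → τ ≡ τ′
    high-cell-unique |τ| |τ′| x∈Aτ y∈Aτ′ L≤fx L≤fy = avoider-unique levels levels-length levels-incomparable
      _ _ |τ| |τ′| (high-avoids |τ| x∈Aτ L≤fx) (high-avoids |τ′| y∈Aτ′ L≤fy)

  high-separated : ∀ {L x y} → L ≤ l k → InInterval j k x → InInterval j k y → L ≤ f x → L ≤ f y →
    x ≢ y → 2 ^ L < 2 * ∣ x - y ∣
  high-separated {L} {x} {y} L≤l x∈J y∈J L≤fx L≤fy x≢y with cover L≤l x∈J | cover L≤l y∈J
  ... | τ , |τ| , x∈Aτ | τ′ , |τ′| , y∈Aτ′ =
    subst (λ e → 2 ^ e < 2 * ∣ x - y ∣) |τ′|
      (spread τ′ (subst (_≤ l k) (sym |τ′|) L≤l) x y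
        (subst (λ σ → A k σ x) (high-cell-unique L≤l |τ| |τ′| x∈Aτ y∈Aτ′ L≤fx L≤fy) x∈Aτ) y∈Aτ′ x≢y)

n≤2^n : ∀ n → n ≤ 2 ^ n
n≤2^n zero = z≤n
n≤2^n (suc n) = +-mono-≤ (m^n>0 2 n) (≤-trans (n≤2^n n) (m≤m+n (2 ^ n) 0))

/-≡⇒<+ : ∀ x y d .{{_ : NonZero d}} → x / d ≡ y / d → y < x + d
/-≡⇒<+ x y d x/d≡y/d = begin-strict
  y                     ≡⟨ m≡m%n+[m/n]*n y d ⟩
  y % d + (y / d) * d   <⟨ +-monoˡ-< ((y / d) * d) (m%n<n y d) ⟩
  d + (y / d) * d       ≡⟨ cong (λ q → d + q * d) (sym x/d≡y/d) ⟩
  d + (x / d) * d       ≤⟨ +-monoʳ-≤ d (m/n*n≤m x d) ⟩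
  d + x                 ≡⟨ +-comm d x ⟩
  x + d                 ∎
  where open ≤-Reasoning

m≤n<m+o⇒∣m-n∣<o : ∀ {m n o} → m ≤ n → n < m + o → ∣ m - n ∣ < o
m≤n<m+o⇒∣m-n∣<o {m} {n} {o} m≤n n<m+o = begin-strict
  ∣ m - n ∣     ≡⟨ m≤n⇒∣m-n∣≡n∸m m≤n ⟩
  n ∸ m         <⟨ ∸-monoˡ-< n<m+o m≤n ⟩
  m + o ∸ m     ≡⟨ m+n∸m≡n m o ⟩
  o             ∎
  where open ≤-Reasoning

/-≡⇒∣-∣< : ∀ x y d .{{_ : NonZero d}} → x / d ≡ y / d → ∣ x - y ∣ < d
/-≡⇒∣-∣< x y d x/d≡y/d with ≤-total x y
... | inj₁ x≤y = m≤n<m+o⇒∣m-n∣<o x≤y (/-≡⇒<+ x y d x/d≡y/d)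
... | inj₂ y≤x = subst (_< d) (∣-∣-comm y x) (m≤n<m+o⇒∣m-n∣<o y≤x (/-≡⇒<+ y x d (sym x/d≡y/d)))

parity[1+n]≢parity[n] : ∀ n → parity (suc n) ≢ parity n
parity[1+n]≢parity[n] n eq = p≢p⁻¹ (parity n) (sym (trans (cong _⁻¹ (sym eq)) (suc-homo-⁻¹ n)))

bit : Parity → ℕ
bit 0ℙ = 0
bit 1ℙ = 1

2*+bit-injective : ∀ a b p q → 2 * a + bit p ≡ 2 * b + bit q → a ≡ b × p ≡ q
2*+bit-injective a b 0ℙ 0ℙ eq = *-cancelˡ-≡ a b 2 (+-cancelʳ-≡ 0 _ _ eq) , refl
2*+bit-injective a b 1ℙ 1ℙ eq = *-cancelˡ-≡ a b 2 (+-cancelʳ-≡ 1 _ _ eq) , refl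
2*+bit-injective a b 0ℙ 1ℙ eq = contradiction (trans (sym (+-identityʳ _)) (trans eq (+-comm _ 1))) (even≢odd a b)
2*+bit-injective a b 1ℙ 0ℙ eq = contradiction (trans (sym (+-identityʳ _)) (trans (sym eq) (+-comm _ 1))) (even≢odd b a)

bit<2 : ∀ p → bit p < 2
bit<2 0ℙ = s≤s z≤n
bit<2 1ℙ = s≤s (s≤s z≤n)

module StrictlyIncreasing (s : ℕ → ℕ) (s-inc : ∀ n → s n < s (suc n)) where

  mono-≤ : ∀ {a b} → a ≤ b → s a ≤ s b
  mono-≤ {a} a≤b with m≤n⇒m<n∨m≡n a≤b
  ... | inj₂ refl = ≤-refl
  ... | inj₁ (s≤s a≤b′) = ≤-trans (mono-≤ a≤b′) (<⇒≤ (s-inc _))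

  cancel-< : ∀ {a b} → s a < s b → a < b
  cancel-< {a} {b} sa<sb with a <? b
  ... | yes a<b = a<b
  ... | no a≮b = contradiction (mono-≤ (≮⇒≥ a≮b)) (<⇒≱ sa<sb)

  id≤ : ∀ n → n ≤ s n
  id≤ zero = z≤n
  id≤ (suc n) = <-≤-trans (s≤s (id≤ n)) (s-inc n)

module Density {j l : ℕ → ℕ} (jP : IsIntervalPartition j) (l≥id : ∀ n → n ≤ l n)
  (|J| : ∀ n → j (suc n) ∸ j n ≡ 2 ^ l n) {A : Family} (good : GoodFamily j l A)
  {f : ℕ → ℕ} (f∈F : InF j l A f) {i : ℕ → ℕ} (iP : IsIntervalPartition i) where

  module J = StrictlyIncreasing j (proj₂ jP)
  module I = StrictlyIncreasing i (proj₂ iP)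

  j-step : ∀ n → j (suc n) ≡ j n + 2 ^ l n
  j-step n = trans (sym (m+[n∸m]≡n (<⇒≤ (proj₂ jP n)))) (cong (j n +_) (|J| n))

  Z-tail : ∀ L {x} → Z i j f x → j (i L) ≤ x → ∃[ k ] InInterval j k x × i L ≤ k × L ≤ f x
  Z-tail L (l′ , k , (_ , k<i[1+l′]) , x∈J , l′≤fx) j[iL]≤x =
    k , x∈J , iL≤k , ≤-trans (≤-pred (I.cancel-< (≤-<-trans iL≤k k<i[1+l′]))) l′≤fx
    where
    iL≤k : i L ≤ k
    iL≤k = ≤-pred (J.cancel-< (≤-<-trans j[iL]≤x (proj₂ x∈J)))

  module Window (Q : ℕ) where

    M d L C : ℕ
    M = 4 * Q
    d = 2 ^ M
    L = suc M
    C = j (i L)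

    instance
      d≢0 : NonZero d
      d≢0 = m^n≢0 2 M

    L≤l : ∀ {k} → i L ≤ k → L ≤ l k
    L≤l iL≤k = ≤-trans (I.id≤ L) (≤-trans iL≤k (l≥id _))

    -- Blocks past i L are longer than a window, and blocks k < k′ of equal parity have
    -- the whole block k + 1 between them.
    same-parity⇒different-windows : ∀ {k k′ x y} → i L ≤ k → k < k′ → parity k ≡ parity k′ →
      InInterval j k x → InInterval j k′ y → x / d ≢ y / d
    same-parity⇒different-windows {k} {k′} {x} {y} iL≤k k<k′ same-parity x∈J y∈J same-window
      with m≤n⇒m<n∨m≡n k<k′
    ... | inj₂ refl = parity[1+n]≢parity[n] k (sym same-parity)
    ... | inj₁ 1+k<k′ = <-irrefl refl (<-trans (/-≡⇒<+ x y d same-window) (begin-strict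
      x + d                         <⟨ +-mono-<-≤ (proj₂ x∈J) (^-monoʳ-≤ 2 M≤l) ⟩
      j (suc k) + 2 ^ l (suc k)     ≡⟨ sym (j-step (suc k)) ⟩
      j (suc (suc k))               ≤⟨ J.mono-≤ 1+k<k′ ⟩
      j k′                          ≤⟨ proj₁ y∈J ⟩
      y                             ∎))
      where
      open ≤-Reasoning
      M≤l : M ≤ l (suc k)
      M≤l = ≤-trans (n≤1+n M) (L≤l (≤-trans iL≤k (n≤1+n k)))

    same-window⇒≡ : ∀ {k k′ x y} → i L ≤ k → i L ≤ k′ → InInterval j k x → InInterval j k′ y →
      L ≤ f x → L ≤ f y → parity k ≡ parity k′ → x / d ≡ y / d → x ≡ y
    same-window⇒≡ {k} {k′} {x} {y} iL≤k iL≤k′ x∈J y∈J L≤fx L≤fy same-parity same-window with <-cmp k k′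
    ... | tri< k<k′ _ _ = contradiction same-window (same-parity⇒different-windows iL≤k k<k′ same-parity x∈J y∈J)
    ... | tri> _ _ k′<k = contradiction (sym same-window)
                            (same-parity⇒different-windows iL≤k′ k′<k (sym same-parity) y∈J x∈J)
    ... | tri≈ _ refl _ with x ≟ y
    ...   | yes x≡y = x≡y
    -- 2 ^ L = 2 * d: distinct high points of one block are more than a window apart.
    ...   | no x≢y = contradiction (/-≡⇒∣-∣< x y d same-window)
              (≤⇒≯ (<⇒≤ (*-cancelˡ-< 2 d ∣ x - y ∣
                (HighValues.high-separated good f∈F k (L≤l iL≤k) x∈J y∈J L≤fx L≤fy x≢y))))

    Code : ℕ → ℕ → Set
    Code x c = (x < C × c ≡ x)
             ⊎ (∃[ k ] InInterval j k x × i L ≤ k × L ≤ f x × c ≡ C + (2 * (x / d) + bit (parity k)))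

    code : ∀ n {x} → x < suc n × Z i j f x → ∃[ c ] c < C + (2 * (n / d) + 2) × Code x c
    code n {x} (x≤n , x∈Z) with x <? C
    ... | yes x<C = x , ≤-trans x<C (m≤m+n C _) , inj₁ (x<C , refl)
    ... | no x≮C with Z-tail L x∈Z (≮⇒≥ x≮C)
    ...   | k , x∈J , iL≤k , L≤fx =
      C + (2 * (x / d) + bit (parity k)) ,
      +-monoʳ-< C (+-mono-≤-< (*-monoʳ-≤ 2 (/-monoˡ-≤ d (≤-pred x≤n))) (bit<2 (parity k))) ,
      inj₂ (k , x∈J , iL≤k , L≤fx , refl)

    Code-injective : ∀ {x y c} → Code x c → Code y c → x ≡ y
    Code-injective (inj₁ (_ , c≡x)) (inj₁ (_ , c≡y)) = trans (sym c≡x) c≡y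
    Code-injective (inj₁ (x<C , c≡x)) (inj₂ (_ , _ , _ , _ , c≡)) =
      contradiction (≤-trans (m≤m+n C _) (≤-reflexive (trans (sym c≡) c≡x))) (<⇒≱ x<C)
    Code-injective (inj₂ (_ , _ , _ , _ , c≡)) (inj₁ (y<C , c≡y)) =
      contradiction (≤-trans (m≤m+n C _) (≤-reflexive (trans (sym c≡) c≡y))) (<⇒≱ y<C)
    Code-injective {x} {y} (inj₂ (k , x∈J , iL≤k , L≤fx , c≡x)) (inj₂ (k′ , y∈J , iL≤k′ , L≤fy , c≡y))
      with 2*+bit-injective (x / d) (y / d) (parity k) (parity k′) (+-cancelˡ-≡ C _ _ (trans (sym c≡x) c≡y))
    ... | same-window , same-parity = same-window⇒≡ iL≤k iL≤k′ x∈J y∈J L≤fx L≤fy same-parity same-window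

    count≤ : ∀ n c → HasCard (λ m → m < suc n × Z i j f m) c → c ≤ C + (2 * (n / d) + 2)
    count≤ n c (xs , unique , sound , _ , |xs|≡c) =
      subst (_≤ _) |xs|≡c (length≤-of-injectiveCoding Code unique (λ x∈xs → code n (sound _ x∈xs)) Code-injective)

    N : ℕ
    N = 2 * ((C + 2) * Q)

    count≤⇒sparse : ∀ n c → N ≤ n → c ≤ C + (2 * (n / d) + 2) → c * Q < suc n
    count≤⇒sparse n c N≤n c≤ = s≤s (*-cancelˡ-≤ 2 (begin
      2 * (c * Q)                          ≤⟨ *-monoʳ-≤ 2 (*-monoˡ-≤ Q c≤) ⟩
      2 * ((C + (2 * (n / d) + 2)) * Q)    ≡⟨ expand C (n / d) Q ⟩
      N + M * (n / d)                      ≤⟨ +-mono-≤ N≤n (*-monoˡ-≤ (n / d) (n≤2^n M)) ⟩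
      n + d * (n / d)                      ≡⟨ cong (n +_) (*-comm d (n / d)) ⟩
      n + (n / d) * d                      ≤⟨ +-monoʳ-≤ n (m/n*n≤m n d) ⟩
      n + n                                ≡⟨ cong (n +_) (sym (+-identityʳ n)) ⟩
      2 * n                                ∎))
      where
      open ≤-Reasoning
      expand : ∀ C a Q → 2 * ((C + (2 * a + 2)) * Q) ≡ 2 * ((C + 2) * Q) + (4 * Q) * a
      expand = solve-∀ where open import Data.Nat.Tactic.RingSolver

    eventually-sparse : ∃[ N ] ∀ n → N ≤ n → ∀ c → HasCard (λ m → m < suc n × Z i j f m) c → c * Q < suc n
    eventually-sparse = N , λ n N≤n c card → count≤⇒sparse n c N≤n (count≤ n c card)

/<-by-cross : ∀ (z : ℤ) n (r : ℚ) → z ℤ.* ↧ r ℤ.< ↥ r ℤ.* ℤ.+ suc n → z ℚ./ suc n ℚ.< r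
/<-by-cross z n r@(mkℚ _ _ _) cross =
  toℚᵘ-cancel-< (ℚᵘ.<-respˡ-≃ (ℚᵘ.≃-sym (toℚᵘ-fromℚᵘ (mkℚᵘ z n))) (ℚᵘ.*<* cross))

lemma3p6 : (j l : ℕ → ℕ) → IsIntervalPartition j
    → (∀ n → 0 < l n) → (∀ n → n ≤ l n) → (∀ n → j (suc n) ∸ j n ≡ 2 ^ l n)
    → (A : Family) → GoodFamily j l A
    → (f : ℕ → ℕ) → InF j l A f
    → (i : ℕ → ℕ) → IsIntervalPartition i
    → DensityZero (Z i j f)
lemma3p6 j l jP _ l≥id |J| A good f f∈F i iP ε@(mkℚ (ℤ.+ suc p) q _) _
  with Density.Window.eventually-sparse jP l≥id |J| good f∈F iP (suc q)
... | N , sparse = N , λ n N≤n c card → /<-by-cross (ℤ.+ c) n ε (cross c n (sparse n N≤n c card))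
  where
  cross : ∀ c n → c * suc q < suc n → ℤ.+ c ℤ.* ℤ.+ suc q ℤ.< ℤ.+ suc p ℤ.* ℤ.+ suc n
  cross c n c*Q<1+n = subst₂ ℤ._<_ (pos-* c (suc q)) (pos-* (suc p) (suc n))
    (+<+ (<-≤-trans c*Q<1+n (m≤m+n (suc n) _)))
lemma3p6 _ _ _ _ _ _ _ _ _ _ _ _ (mkℚ (ℤ.+ 0) _ _) (*<* (+<+ ()))
lemma3p6 _ _ _ _ _ _ _ _ _ _ _ _ (mkℚ -[1+ _ ] _ _) (*<* ())
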